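{- Let $\Gamma$ be a strongly regular graph of type II with parameters $(v,k,\lambda,\mu)$ and restricted eigenvalues $\rho>\sigma$, let $d$ be an integer with $0\le d<k$, and let $h_d=v\frac{d-\sigma}{k-\sigma}$. If $d\le k-\frac{(k-\sigma)(k-\sigma-1)}{v}$, then $[x_{\lfloor h_d\rfloor}]=[x_{h_d}]$.
   Context: A graph is strongly regular with parameters $(v,k,\lambda,\mu)$ if it has $v$ vertices, is $k$-regular, is neither complete nor edgeless, every two adjacent vertices have exactly $\lambda$ common neighbours, and every two distinct non-adjacent vertices have exactly $\mu$ common neighbours. Its restricted eigenvalues $\rho>\sigma$ are the roots of $t^2-(\lambda-\mu)t-(k-\mu)=0$; it is of type II if all its eigenvalues are integers. For $y<v$ (and fixed $d$), $x_y=\frac{2y(k-d)-(v-y)}{2(v-y)}$. For real $x$, $[x]=\lceil x-1/2\rceil$. -}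

module Defs where

open import Data.Bool using (Bool; true; false)
open import Data.Nat as ℕ using (ℕ)
open import Data.Integer as ℤ using (ℤ; +_)
open import Data.Rational as ℚ using (ℚ; 0ℚ; ½; floor; ceiling; _/_; _-_; _+_; _*_; _÷_; ≢-nonZero)
open import Data.Rational.Properties using (_≟_)
open import Data.Fin using (Fin)
open import Data.List using (List; length; filterᵇ)
open import Data.List using () renaming (allFin to allFinL)
open import Data.Bool using (_∧_)
open import Data.Product using (Σ; ∃; _×_; _,_)
open import Relation.Binary.PropositionalEquality using (_≡_; _≢_)
open import Relation.Nullary using (yes; no)

record Graph (v : ℕ) : Set where
  field
    adj     : Fin v → Fin v → Bool
    symm    : ∀ i j → adj i j ≡ adj j i
    irrefl  : ∀ i → adj i i ≡ false

open Graph public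

vertices : (v : ℕ) → List (Fin v)
vertices v = allFinL v

degree : ∀ {v} → Graph v → Fin v → ℕ
degree {v} G i = length (filterᵇ (adj G i) (vertices v))

common : ∀ {v} → Graph v → Fin v → Fin v → ℕ
common {v} G i j = length (filterᵇ (λ w → adj G i w ∧ adj G j w) (vertices v))

record IsSRG {v : ℕ} (G : Graph v) (k lam mu : ℕ) : Set where
  field
    regular       : ∀ i → degree G i ≡ k
    notComplete   : Σ (Fin v) λ i → Σ (Fin v) λ j → (i ≢ j) × (adj G i j ≡ false)
    notEdgeless   : Σ (Fin v) λ i → Σ (Fin v) λ j → adj G i j ≡ true
    adjCommon     : ∀ i j → adj G i j ≡ true → common G i j ≡ lam
    nonadjCommon  : ∀ i j → i ≢ j → adj G i j ≡ false → common G i j ≡ mu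

ℤ→ℚ : ℤ → ℚ
ℤ→ℚ z = z / 1

ℕ→ℚ : ℕ → ℚ
ℕ→ℚ n = ℤ→ℚ (+ n)

-- total division (junk value 0 when dividing by 0; never used at 0 below)
_÷'_ : ℚ → ℚ → ℚ
p ÷' q with q ≟ 0ℚ
... | yes _  = 0ℚ
... | no q≢0 = _÷_ p q {{≢-nonZero q≢0}}

nearest : ℚ → ℤ
nearest x = ceiling (x - ½)

-- x_y = (2y(k-d) - (v-y)) / (2(v-y))   (only meaningful for y < v)
xval : (v k d : ℤ) → ℚ → ℚ
xval v k d y =
  ((ℕ→ℚ 2 * y * ℤ→ℚ (k ℤ.- d)) - (ℤ→ℚ v - y)) ÷' (ℕ→ℚ 2 * (ℤ→ℚ v - y))

hval : (v k d σ : ℤ) → ℚ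
hval v k d σ = (ℤ→ℚ v * ℤ→ℚ (d ℤ.- σ)) ÷' ℤ→ℚ (k ℤ.- σ)

module Submission where

-- Write a = d - σ, δ = k - d and b = k - σ = a + δ.  Since x_y - 1/2 = yδ/(v - y) - 1, we get
-- [x_y] = a - 1 as soon as (a - 1)(v - y) < yδ ≤ a(v - y).  For y = h_d = va/b the right-hand
-- inequality is an equality.  For y = f = ⌊h_d⌋ write va = fb + r with 0 ≤ r < b: the right-hand
-- inequality says r ≥ 0 and the left-hand one says v - f - r > 0, which holds because
-- b(v - f - r) = vδ - r(b - 1) ≥ vδ - (b - 1)² > 0, using b(b - 1) ≤ vδ and vδ > 0.
-- Finally b > 0 because σ ≤ 0, which follows from ρσ = μ - k ≤ 0.

open import Defs
open import Data.Nat using (ℕ)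
open import Data.Integer as ℤ using (ℤ; +_)
open import Data.Rational as ℚ using (ℚ; floor)
open import Relation.Binary.PropositionalEquality using (_≡_)

open import Data.Bool using (T?; _∧_)
open import Data.Bool.Properties using (T-∧)
open import Data.Empty using (⊥-elim)
open import Data.Fin.Properties using (nonZeroIndex)
open import Data.Integer using (+[1+_])
import Data.Integer.Properties as ℤP
open import Data.Integer.DivMod using ([n/d]*d≤n; n<s[n/ℕd]*d; div-pos-is-/ℕ)
open import Data.Integer.Tactic.RingSolver using () renaming (ring to ℤ-ring)
open import Data.List.Relation.Binary.Sublist.Propositional using (⊆-refl)
open import Data.List.Relation.Binary.Sublist.Propositional.Properties using (filter⁺; length-mono-≤)
open import Data.Maybe using (just; nothing)
import Data.Nat as ℕ
import Data.Nat.Coprimality as Coprime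
import Data.Nat.Properties as ℕP
open import Data.Product using (_×_; _,_; proj₁; proj₂)
open import Data.Rational using (mkℚ; 0ℚ; 1ℚ; ½; 1/_; ↧_; ↧ₙ_; *≤*; *<*; ceiling)
import Data.Rational.Properties as ℚP
open import Algebra.Properties.Group ℚP.+-0-group using (inverseˡ-unique)
open import Function using (_∘_; case_of_; Equivalence)
open import Level using (0ℓ)
open import Relation.Binary.PropositionalEquality
  using (_≢_; refl; sym; trans; cong; cong₂; subst; subst₂; ≢-sym; module ≡-Reasoning)
open import Relation.Nullary using (yes; no)
open import Tactic.RingSolver using (solve-∀)
import Tactic.RingSolver.Core.AlmostCommutativeRing as ACR

ℚ-ring : ACR.AlmostCommutativeRing 0ℓ 0ℓ
ℚ-ring = ACR.fromCommutativeRing ℚP.+-*-commutativeRing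
  λ p → case p ℚP.≟ 0ℚ of λ { (yes p≡0) → just (sym p≡0) ; (no _) → nothing }

module _ where
  open Data.Integer using (_+_; _-_; _*_; _≤_; _<_)

  i<j⇒0<j-i : ∀ {i j} → i < j → + 0 < j - i
  i<j⇒0<j-i {i} {j} i<j = subst (_< j - i) (ℤP.+-inverseʳ i) (ℤP.+-monoˡ-< (ℤ.- i) i<j)

  0<i-j⇒j<i : ∀ {i j} → + 0 < i - j → j < i
  0<i-j⇒j<i {i} {j} 0<i-j = subst₂ _<_ (ℤP.+-identityˡ j) (eq i j) (ℤP.+-monoˡ-< j 0<i-j)
    where
    eq : ∀ i j → i - j + j ≡ i
    eq = solve-∀ ℤ-ring

  i<j⇒j*i≤0⇒i≤0 : ∀ {i j} → i < j → j * i ≤ + 0 → i ≤ + 0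
  i<j⇒j*i≤0⇒i≤0 {i} {j} i<j ji≤0 = ℤP.≮⇒≥ λ 0<i →
    ℤP.<-irrefl refl
      (ℤP.<-≤-trans (ℤP.*-monoʳ-<-pos i {{ℤ.positive 0<i}} (ℤP.<-trans 0<i i<j)) ji≤0)

  [b-1]²<m : ∀ {b m} → + 0 < b → + 0 < m → b * (b - + 1) ≤ m → (b - + 1) * (b - + 1) < m
  [b-1]²<m {+ ℕ.zero} (ℤ.+<+ ())
  [b-1]²<m {+[1+ ℕ.zero ]}  _ 0<m _ = 0<m
  [b-1]²<m {+[1+ ℕ.suc n ]} _ _ b[b-1]≤m =
    ℤP.<-≤-trans (ℤP.*-monoʳ-<-pos +[1+ n ] {+[1+ n ]} (ℤ.+<+ ℕP.≤-refl)) b[b-1]≤m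

  floor-window : ∀ {v a δ b f} → a + δ ≡ b → + 0 < v → + 0 < δ →
    f * b ≤ v * a → v * a < ℤ.suc f * b → b * (b - + 1) ≤ v * δ →
    (a - + 1) * (v - f) < f * δ × f * δ ≤ a * (v - f)
  floor-window {v} {a} {δ} {f = f} refl 0<v 0<δ fb≤va va<[f+1]b b[b-1]≤vδ = lower , upper
    where
    b r : ℤ
    b = a + δ
    r = v * a - f * b
    0≤r : + 0 ≤ r
    0≤r = ℤP.i≤j⇒0≤j-i fb≤va
    r<b : r < b
    r<b = subst (r <_) (eq f b) (ℤP.+-monoˡ-< (ℤ.- (f * b)) va<[f+1]b)
      where
      eq : ∀ f b → (+ 1 + f) * b - f * b ≡ b
      eq = solve-∀ ℤ-ring
    0<b : + 0 < b
    0<b = ℤP.≤-<-trans 0≤r r<b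
    r≤b-1 : r ≤ b - + 1
    r≤b-1 = subst (r ≤_) (ℤP.+-comm ℤ.-1ℤ b) (ℤP.i<j⇒i≤pred[j] r<b)
    instance
      _ = ℤ.nonNegative (ℤP.≤-trans 0≤r r≤b-1)
      _ = ℤ.nonNegative (ℤP.<⇒≤ 0<b)
    r[b-1]<vδ : r * (b - + 1) < v * δ
    r[b-1]<vδ = ℤP.≤-<-trans (ℤP.*-monoʳ-≤-nonNeg (b - + 1) r≤b-1)
                             ([b-1]²<m 0<b (ℤP.*-monoʳ-<-pos δ {{ℤ.positive 0<δ}} 0<v) b[b-1]≤vδ)
    0<v-f-r : + 0 < v - f - r
    0<v-f-r = ℤP.*-cancelʳ-<-nonNeg b (subst (+ 0 <_) (eq v a δ f) (i<j⇒0<j-i r[b-1]<vδ))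
      where
      eq : ∀ v a δ f → v * δ - (v * a - f * (a + δ)) * (a + δ - + 1)
                     ≡ (v - f - (v * a - f * (a + δ))) * (a + δ)
      eq = solve-∀ ℤ-ring
    upper : f * δ ≤ a * (v - f)
    upper = ℤP.0≤i-j⇒j≤i (subst (+ 0 ≤_) (eq v a δ f) 0≤r)
      where
      eq : ∀ v a δ f → v * a - f * (a + δ) ≡ a * (v - f) - f * δ
      eq = solve-∀ ℤ-ring
    lower : (a - + 1) * (v - f) < f * δ
    lower = 0<i-j⇒j<i (subst (+ 0 <_) (eq v a δ f) 0<v-f-r)
      where
      eq : ∀ v a δ f → v - f - (v * a - f * (a + δ)) ≡ f * δ - (a - + 1) * (v - f)
      eq = solve-∀ ℤ-ring

module _ where
  open Data.Rational using (_+_; _-_; -_; _*_; _≤_; _<_)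

  p<q⇒0<q-p : ∀ {p q} → p < q → 0ℚ < q - p
  p<q⇒0<q-p {p} {q} p<q = subst (_< q - p) (ℚP.+-inverseʳ p) (ℚP.+-monoˡ-< (- p) p<q)

  0<q-p⇒p<q : ∀ {p q} → 0ℚ < q - p → p < q
  0<q-p⇒p<q {p} {q} 0<q-p = subst₂ _<_ (ℚP.+-identityˡ p) (eq p q) (ℚP.+-monoˡ-< p 0<q-p)
    where
    eq : ∀ p q → q - p + p ≡ q
    eq = solve-∀ ℚ-ring

  p≤q-r⇒r≤q-p : ∀ {p q r} → p ≤ q - r → r ≤ q - p
  p≤q-r⇒r≤q-p {p} {q} {r} p≤q-r = subst₂ _≤_ (eq₁ p r) (eq₂ p q r) (ℚP.+-monoˡ-≤ (r - p) p≤q-r)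
    where
    eq₁ : ∀ p r → p + (r - p) ≡ r
    eq₁ = solve-∀ ℚ-ring
    eq₂ : ∀ p q r → q - r + (r - p) ≡ q - p
    eq₂ = solve-∀ ℚ-ring

  0<p⇒0<q⇒0<p*q : ∀ {p q} → 0ℚ < p → 0ℚ < q → 0ℚ < p * q
  0<p⇒0<q⇒0<p*q {p} {q} 0<p 0<q =
    ℚP.positive⁻¹ (p * q) {{ℚP.pos*pos⇒pos p {{ℚ.positive 0<p}} q {{ℚ.positive 0<q}}}}

  ÷'-*-cancel : ∀ p {q} → q ≢ 0ℚ → (p ÷' q) * q ≡ p
  ÷'-*-cancel p {q} q≢0 with q ℚP.≟ 0ℚ
  ... | yes q≡0 = ⊥-elim (q≢0 q≡0)
  ... | no  q≢0 = begin
    p * 1/ q * q    ≡⟨ ℚP.*-assoc p (1/ q) q ⟩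
    p * (1/ q * q)  ≡⟨ cong (p *_) (ℚP.*-inverseˡ q) ⟩
    p * 1ℚ          ≡⟨ ℚP.*-identityʳ p ⟩
    p               ∎
    where
    open ≡-Reasoning
    instance _ = ℚ.≢-nonZero q≢0

  ℤ→ℚ≡mkℚ : ∀ z → ℤ→ℚ z ≡ mkℚ z 0 (Coprime.sym (Coprime.1-coprimeTo ℤ.∣ z ∣))
  ℤ→ℚ≡mkℚ z = ℚP.↥p/↧p≡p _

  ℤ→ℚ-+ : ∀ a b → ℤ→ℚ (a ℤ.+ b) ≡ ℤ→ℚ a + ℤ→ℚ b
  ℤ→ℚ-+ a b rewrite ℤ→ℚ≡mkℚ a | ℤ→ℚ≡mkℚ b = cong (ℚ._/ 1) (eq a b)
    where
    eq : ∀ a b → a ℤ.+ b ≡ a ℤ.* + 1 ℤ.+ b ℤ.* + 1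
    eq = solve-∀ ℤ-ring

  ℤ→ℚ-* : ∀ a b → ℤ→ℚ (a ℤ.* b) ≡ ℤ→ℚ a * ℤ→ℚ b
  ℤ→ℚ-* a b rewrite ℤ→ℚ≡mkℚ a | ℤ→ℚ≡mkℚ b = refl

  ℤ→ℚ-neg : ∀ a → ℤ→ℚ (ℤ.- a) ≡ - ℤ→ℚ a
  ℤ→ℚ-neg a = inverseˡ-unique (ℤ→ℚ (ℤ.- a)) (ℤ→ℚ a)
    (trans (sym (ℤ→ℚ-+ (ℤ.- a) a)) (cong ℤ→ℚ (ℤP.+-inverseˡ a)))

  ℤ→ℚ-sub : ∀ a b → ℤ→ℚ (a ℤ.- b) ≡ ℤ→ℚ a - ℤ→ℚ b
  ℤ→ℚ-sub a b = trans (ℤ→ℚ-+ a (ℤ.- b)) (cong (λ x → ℤ→ℚ a + x) (ℤ→ℚ-neg b))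

  ℤ→ℚ-mono-≤ : ∀ {a b} → a ℤ.≤ b → ℤ→ℚ a ≤ ℤ→ℚ b
  ℤ→ℚ-mono-≤ {a} {b} a≤b rewrite ℤ→ℚ≡mkℚ a | ℤ→ℚ≡mkℚ b =
    *≤* (subst₂ ℤ._≤_ (sym (ℤP.*-identityʳ a)) (sym (ℤP.*-identityʳ b)) a≤b)

  ℤ→ℚ-mono-< : ∀ {a b} → a ℤ.< b → ℤ→ℚ a < ℤ→ℚ b
  ℤ→ℚ-mono-< {a} {b} a<b rewrite ℤ→ℚ≡mkℚ a | ℤ→ℚ≡mkℚ b =
    *<* (subst₂ ℤ._<_ (sym (ℤP.*-identityʳ a)) (sym (ℤP.*-identityʳ b)) a<b)

  ℤ→ℚ-cancel-≤ : ∀ {a b} → ℤ→ℚ a ≤ ℤ→ℚ b → a ℤ.≤ b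
  ℤ→ℚ-cancel-≤ {a} {b} a≤b rewrite ℤ→ℚ≡mkℚ a | ℤ→ℚ≡mkℚ b with a≤b
  ... | *≤* a*1≤b*1 = subst₂ ℤ._≤_ (ℤP.*-identityʳ a) (ℤP.*-identityʳ b) a*1≤b*1

  ℤ→ℚ-cancel-< : ∀ {a b} → ℤ→ℚ a < ℤ→ℚ b → a ℤ.< b
  ℤ→ℚ-cancel-< {a} {b} a<b rewrite ℤ→ℚ≡mkℚ a | ℤ→ℚ≡mkℚ b with a<b
  ... | *<* a*1<b*1 = subst₂ ℤ._<_ (ℤP.*-identityʳ a) (ℤP.*-identityʳ b) a*1<b*1

  ⌊p⌋≤p : ∀ p → ℤ→ℚ (floor p) ≤ p
  ⌊p⌋≤p p@(mkℚ n _ _) rewrite ℤ→ℚ≡mkℚ (floor p) =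
    *≤* (subst (floor p ℤ.* ↧ p ℤ.≤_) (sym (ℤP.*-identityʳ n)) ([n/d]*d≤n n (↧ p)))

  p<suc⌊p⌋ : ∀ p → p < ℤ→ℚ (ℤ.suc (floor p))
  p<suc⌊p⌋ p@(mkℚ n _ _) rewrite ℤ→ℚ≡mkℚ (ℤ.suc (floor p)) =
    *<* (subst₂ ℤ._<_ (sym (ℤP.*-identityʳ n))
                       (cong (λ q → ℤ.suc q ℤ.* ↧ p) (sym (div-pos-is-/ℕ n (↧ₙ p))))
                       (n<s[n/ℕd]*d n (↧ₙ p)))

  floor-unique : ∀ {m p} → ℤ→ℚ m ≤ p → p < ℤ→ℚ (ℤ.suc m) → floor p ≡ m
  floor-unique {m} {p} m≤p p<m+1 =
    ℤP.≤-antisym (<suc⇒≤ (ℤ→ℚ-cancel-< (ℚP.≤-<-trans (⌊p⌋≤p p) p<m+1)))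
                 (<suc⇒≤ (ℤ→ℚ-cancel-< (ℚP.≤-<-trans m≤p (p<suc⌊p⌋ p))))
    where
    <suc⇒≤ : ∀ {i j} → i ℤ.< ℤ.suc j → i ℤ.≤ j
    <suc⇒≤ {i} {j} i<j+1 = subst (i ℤ.≤_) (ℤP.pred-suc j) (ℤP.i<j⇒i≤pred[j] i<j+1)

  ceiling-unique : ∀ {n p} → ℤ→ℚ (n ℤ.- + 1) < p → p ≤ ℤ→ℚ n → ceiling p ≡ n
  ceiling-unique {n} {p@record{}} n-1<p p≤n = begin
    ℤ.- floor (- p)  ≡⟨ cong ℤ.-_ (floor-unique -n≤-p -p<1-n) ⟩
    ℤ.- ℤ.- n        ≡⟨ ℤP.neg-involutive n ⟩
    n                ∎
    where
    open ≡-Reasoning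
    -n≤-p : ℤ→ℚ (ℤ.- n) ≤ - p
    -n≤-p = subst (_≤ - p) (sym (ℤ→ℚ-neg n)) (ℚP.neg-antimono-≤ p≤n)
    1-n≡-[n-1] : ℤ→ℚ (ℤ.suc (ℤ.- n)) ≡ - ℤ→ℚ (n ℤ.- + 1)
    1-n≡-[n-1] = trans (cong ℤ→ℚ (eq n)) (ℤ→ℚ-neg (n ℤ.- + 1))
      where
      eq : ∀ n → + 1 ℤ.+ ℤ.- n ≡ ℤ.- (n ℤ.- + 1)
      eq = solve-∀ ℤ-ring
    -p<1-n : - p < ℤ→ℚ (ℤ.suc (ℤ.- n))
    -p<1-n = subst (- p <_) (sym 1-n≡-[n-1]) (ℚP.neg-antimono-< n-1<p)

  nearest-xval : ∀ (v k d a : ℤ) (t : ℚ) →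
    (ℤ→ℚ a - 1ℚ) * (ℤ→ℚ v - t) < t * ℤ→ℚ (k ℤ.- d) →
    t * ℤ→ℚ (k ℤ.- d) ≤ ℤ→ℚ a * (ℤ→ℚ v - t) →
    nearest (xval v k d t) ≡ a ℤ.- + 1
  nearest-xval v k d a t lower upper = ceiling-unique {p = x - ½}
    (ℚP.*-cancelʳ-<-nonNeg M {{ℚP.pos⇒nonNeg M}}
      (subst₂ _<_ (sym [a-2]M) (sym [x-½]M) (ℚP.+-monoˡ-< (- M) lower)))
    (ℚP.*-cancelʳ-≤-pos M (subst₂ _≤_ (sym [x-½]M) (sym [a-1]M) (ℚP.+-monoˡ-≤ (- M) upper)))
    where
    V D A M x : ℚ
    V = ℤ→ℚ v
    D = ℤ→ℚ (k ℤ.- d)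
    A = ℤ→ℚ a
    M = V - t
    x = xval v k d t
    0<M : 0ℚ < M
    0<M = subst (0ℚ <_) (eq A M) (p<q⇒0<q-p (ℚP.<-≤-trans lower upper))
      where
      eq : ∀ A M → A * M - (A - 1ℚ) * M ≡ M
      eq = solve-∀ ℚ-ring
    instance _ = ℚ.positive 0<M
    x*2M : x * (ℕ→ℚ 2 * M) ≡ ℕ→ℚ 2 * t * D - M
    x*2M = ÷'-*-cancel _ {ℕ→ℚ 2 * M} (≢-sym (ℚP.<⇒≢ (0<p⇒0<q⇒0<p*q (ℚP.positive⁻¹ (ℕ→ℚ 2)) 0<M)))
    [x-½]M : (x - ½) * M ≡ t * D - M
    [x-½]M = begin
      (x - ½) * M                          ≡⟨ eq₁ x M ⟩
      ½ * (x * (ℕ→ℚ 2 * M)) - ½ * M        ≡⟨ cong (λ y → ½ * y - ½ * M) x*2M ⟩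
      ½ * (ℕ→ℚ 2 * t * D - M) - ½ * M      ≡⟨ eq₂ t D M ⟩
      t * D - M                            ∎
      where
      open ≡-Reasoning
      eq₁ : ∀ x M → (x - ½) * M ≡ ½ * (x * (ℕ→ℚ 2 * M)) - ½ * M
      eq₁ = solve-∀ ℚ-ring
      eq₂ : ∀ t D M → ½ * (ℕ→ℚ 2 * t * D - M) - ½ * M ≡ t * D - M
      eq₂ = solve-∀ ℚ-ring
    [a-1]M : ℤ→ℚ (a ℤ.- + 1) * M ≡ A * M - M
    [a-1]M = trans (cong (_* M) (ℤ→ℚ-sub a (+ 1))) (eq A M)
      where
      eq : ∀ A M → (A - 1ℚ) * M ≡ A * M - M
      eq = solve-∀ ℚ-ring
    [a-2]M : ℤ→ℚ (a ℤ.- + 1 ℤ.- + 1) * M ≡ (A - 1ℚ) * M - M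
    [a-2]M = trans (cong (_* M) (trans (ℤ→ℚ-sub (a ℤ.- + 1) (+ 1)) (cong (_- 1ℚ) (ℤ→ℚ-sub a (+ 1)))))
                   (eq A M)
      where
      eq : ∀ A M → (A - 1ℚ - 1ℚ) * M ≡ (A - 1ℚ) * M - M
      eq = solve-∀ ℚ-ring

  hval*[k-σ]≡v*[d-σ] : ∀ {v k d σ} → σ ℤ.< k →
    hval v k d σ * ℤ→ℚ (k ℤ.- σ) ≡ ℤ→ℚ v * ℤ→ℚ (d ℤ.- σ)
  hval*[k-σ]≡v*[d-σ] σ<k = ÷'-*-cancel _ (≢-sym (ℚP.<⇒≢ (ℤ→ℚ-mono-< (i<j⇒0<j-i σ<k))))

  nearest-xval-hval : ∀ {v k d σ} → + 0 ℤ.< v → d ℤ.< k → σ ℤ.< k →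
    nearest (xval v k d (hval v k d σ)) ≡ (d ℤ.- σ) ℤ.- + 1
  nearest-xval-hval {v} {k} {d} {σ} 0<v d<k σ<k =
    nearest-xval v k d (d ℤ.- σ) h lower (ℚP.≤-reflexive hD≡AM)
    where
    open ≡-Reasoning
    V A D h M : ℚ
    V = ℤ→ℚ v
    A = ℤ→ℚ (d ℤ.- σ)
    D = ℤ→ℚ (k ℤ.- d)
    h = hval v k d σ
    M = V - h
    B≡A+D : ℤ→ℚ (k ℤ.- σ) ≡ A + D
    B≡A+D = trans (cong ℤ→ℚ (eq k d σ)) (ℤ→ℚ-+ (d ℤ.- σ) (k ℤ.- d))
      where
      eq : ∀ k d σ → k ℤ.- σ ≡ (d ℤ.- σ) ℤ.+ (k ℤ.- d)
      eq = solve-∀ ℤ-ring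
    0<A+D : 0ℚ < A + D
    0<A+D = subst (0ℚ <_) B≡A+D (ℤ→ℚ-mono-< (i<j⇒0<j-i σ<k))
    h[A+D]≡VA : h * (A + D) ≡ V * A
    h[A+D]≡VA = trans (cong (h *_) (sym B≡A+D)) (hval*[k-σ]≡v*[d-σ] {v} {k} {d} σ<k)
    cancel : ∀ X Y → X + (Y - Y) ≡ X
    cancel = solve-∀ ℚ-ring
    hD≡AM : h * D ≡ A * M
    hD≡AM = begin
      h * D                            ≡⟨ eq h A D V ⟩
      A * M + (h * (A + D) - V * A)    ≡⟨ cong (λ y → A * M + (y - V * A)) h[A+D]≡VA ⟩
      A * M + (V * A - V * A)          ≡⟨ cancel (A * M) (V * A) ⟩
      A * M                            ∎
      where
      eq : ∀ h A D V → h * D ≡ A * (V - h) + (h * (A + D) - V * A)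
      eq = solve-∀ ℚ-ring
    M[A+D]≡VD : M * (A + D) ≡ V * D
    M[A+D]≡VD = begin
      M * (A + D)                      ≡⟨ eq h A D V ⟩
      V * D + (V * A - h * (A + D))    ≡⟨ cong (λ y → V * D + (V * A - y)) h[A+D]≡VA ⟩
      V * D + (V * A - V * A)          ≡⟨ cancel (V * D) (V * A) ⟩
      V * D                            ∎
      where
      eq : ∀ h A D V → (V - h) * (A + D) ≡ V * D + (V * A - h * (A + D))
      eq = solve-∀ ℚ-ring
    0<M : 0ℚ < M
    0<M = ℚP.*-cancelʳ-<-nonNeg (A + D) {{ℚ.nonNegative (ℚP.<⇒≤ 0<A+D)}}
            (subst₂ _<_ (sym (ℚP.*-zeroˡ (A + D))) (sym M[A+D]≡VD)
              (0<p⇒0<q⇒0<p*q (ℤ→ℚ-mono-< 0<v) (ℤ→ℚ-mono-< (i<j⇒0<j-i d<k))))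
    lower : (A - 1ℚ) * M < h * D
    lower = 0<q-p⇒p<q (subst (0ℚ <_) M≡hD-[A-1]M 0<M)
      where
      eq : ∀ A M → M ≡ A * M - (A - 1ℚ) * M
      eq = solve-∀ ℚ-ring
      M≡hD-[A-1]M : M ≡ h * D - (A - 1ℚ) * M
      M≡hD-[A-1]M = trans (eq A M) (cong (_- (A - 1ℚ) * M) (sym hD≡AM))

  nearest-xval-⌊hval⌋ : ∀ {v k d σ} → + 0 ℤ.< v → d ℤ.< k → σ ℤ.< k →
    (k ℤ.- σ) ℤ.* (k ℤ.- σ ℤ.- + 1) ℤ.≤ v ℤ.* (k ℤ.- d) →
    nearest (xval v k d (ℤ→ℚ (floor (hval v k d σ)))) ≡ (d ℤ.- σ) ℤ.- + 1
  nearest-xval-⌊hval⌋ {v} {k} {d} {σ} 0<v d<k σ<k b[b-1]≤vδ = nearest-xval v k d a (ℤ→ℚ f)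
    (subst₂ _<_ (trans (ℤ→ℚ-* (a ℤ.- + 1) (v ℤ.- f)) (cong₂ _*_ (ℤ→ℚ-sub a (+ 1)) (ℤ→ℚ-sub v f))) (ℤ→ℚ-* f δ)
      (ℤ→ℚ-mono-< (proj₁ window)))
    (subst₂ _≤_ (ℤ→ℚ-* f δ) (trans (ℤ→ℚ-* a (v ℤ.- f)) (cong (ℤ→ℚ a *_) (ℤ→ℚ-sub v f)))
      (ℤ→ℚ-mono-≤ (proj₂ window)))
    where
    a δ b f : ℤ
    a = d ℤ.- σ
    δ = k ℤ.- d
    b = k ℤ.- σ
    f = floor (hval v k d σ)
    h B : ℚ
    h = hval v k d σ
    B = ℤ→ℚ b
    0<B : 0ℚ < B
    0<B = ℤ→ℚ-mono-< (i<j⇒0<j-i σ<k)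
    instance
      _ = ℚ.positive 0<B
      _ = ℚ.nonNegative (ℚP.<⇒≤ 0<B)
    hB≡va : h * B ≡ ℤ→ℚ (v ℤ.* a)
    hB≡va = trans (hval*[k-σ]≡v*[d-σ] {v} {k} {d} σ<k) (sym (ℤ→ℚ-* v a))
    fb≤va : f ℤ.* b ℤ.≤ v ℤ.* a
    fb≤va = ℤ→ℚ-cancel-≤ (subst₂ _≤_ (sym (ℤ→ℚ-* f b)) hB≡va (ℚP.*-monoʳ-≤-nonNeg B (⌊p⌋≤p h)))
    va<[f+1]b : v ℤ.* a ℤ.< ℤ.suc f ℤ.* b
    va<[f+1]b = ℤ→ℚ-cancel-<
      (subst₂ _<_ hB≡va (sym (ℤ→ℚ-* (ℤ.suc f) b)) (ℚP.*-monoˡ-<-pos B (p<suc⌊p⌋ h)))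
    a+δ≡b : a ℤ.+ δ ≡ b
    a+δ≡b = eq k d σ
      where
      eq : ∀ k d σ → (d ℤ.- σ) ℤ.+ (k ℤ.- d) ≡ k ℤ.- σ
      eq = solve-∀ ℤ-ring
    window : (a ℤ.- + 1) ℤ.* (v ℤ.- f) ℤ.< f ℤ.* δ × f ℤ.* δ ℤ.≤ a ℤ.* (v ℤ.- f)
    window = floor-window a+δ≡b 0<v (i<j⇒0<j-i d<k) fb≤va va<[f+1]b b[b-1]≤vδ

  d≤k-c/v⇒c≤v[k-d] : ∀ {v k d c} → + 0 ℤ.< v →
    ℤ→ℚ d ≤ ℤ→ℚ k - ℤ→ℚ c ÷' ℤ→ℚ v → c ℤ.≤ v ℤ.* (k ℤ.- d)
  d≤k-c/v⇒c≤v[k-d] {v} {k} {d} {c} 0<v d≤k-c/v =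
    ℤ→ℚ-cancel-≤ (subst₂ _≤_ [c/v]v≡c [k-d]v≡v[k-d] (ℚP.*-monoʳ-≤-nonNeg V c/v≤k-d))
    where
    V : ℚ
    V = ℤ→ℚ v
    0<V : 0ℚ < V
    0<V = ℤ→ℚ-mono-< 0<v
    instance _ = ℚ.nonNegative (ℚP.<⇒≤ 0<V)
    c/v≤k-d : ℤ→ℚ c ÷' V ≤ ℤ→ℚ k - ℤ→ℚ d
    c/v≤k-d = p≤q-r⇒r≤q-p {q = ℤ→ℚ k} d≤k-c/v
    [c/v]v≡c : (ℤ→ℚ c ÷' V) * V ≡ ℤ→ℚ c
    [c/v]v≡c = ÷'-*-cancel _ (≢-sym (ℚP.<⇒≢ 0<V))
    [k-d]v≡v[k-d] : (ℤ→ℚ k - ℤ→ℚ d) * V ≡ ℤ→ℚ (v ℤ.* (k ℤ.- d))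
    [k-d]v≡v[k-d] = trans (cong (_* V) (sym (ℤ→ℚ-sub k d)))
                          (trans (ℚP.*-comm _ V) (sym (ℤ→ℚ-* v (k ℤ.- d))))

common≤degree : ∀ {v} (G : Graph v) i j → common G i j ℕ.≤ degree G i
common≤degree G i j = length-mono-≤
  (filter⁺ (λ w → T? (adj G i w ∧ adj G j w)) (λ w → T? (adj G i w))
    (λ { refl → proj₁ ∘ Equivalence.to T-∧ }) (⊆-refl {x = vertices _}))

IsSRG⇒μ≤k : ∀ {v} {G : Graph v} {k lam mu} → IsSRG G k lam mu → mu ℕ.≤ k
IsSRG⇒μ≤k {G = G} srg with IsSRG.notComplete srg
... | i , j , i≢j , i≁j =
  subst₂ ℕ._≤_ (IsSRG.nonadjCommon srg i j i≢j i≁j) (IsSRG.regular srg i) (common≤degree G i j)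

IsSRG⇒0<v : ∀ {v} {G : Graph v} {k lam mu} → IsSRG G k lam mu → 0 ℕ.< v
IsSRG⇒0<v srg = ℕ.>-nonZero⁻¹ _ {{nonZeroIndex (proj₁ (IsSRG.notEdgeless srg))}}

corollary6p11 : (v k lam mu : ℕ) (Γ : Graph v) → IsSRG Γ k lam mu →
    -- type II: the restricted eigenvalues ρ > σ (roots of t² - (λ-μ)t - (k-μ)) are integers
    (ρ σ : ℤ) → σ ℤ.< ρ →
    ρ ℤ.+ σ ≡ + lam ℤ.- + mu → ρ ℤ.* σ ≡ ℤ.- (+ k ℤ.- + mu) →
    (d : ℤ) → + 0 ℤ.≤ d → d ℤ.< + k →
    ℚ._≤_ (ℤ→ℚ d) (ℕ→ℚ k ℚ.- ((ℤ→ℚ (+ k ℤ.- σ) ℚ.* ℤ→ℚ (+ k ℤ.- σ ℤ.- + 1)) ÷' ℕ→ℚ v)) →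
    nearest (xval (+ v) (+ k) d (ℤ→ℚ (floor (hval (+ v) (+ k) d σ))))
      ≡ nearest (xval (+ v) (+ k) d (hval (+ v) (+ k) d σ))
corollary6p11 v k _ _ _ srg ρ σ σ<ρ _ ρσ≡μ-k d 0≤d d<k d≤k-b[b-1]/v =
  trans (nearest-xval-⌊hval⌋ 0<v d<k σ<k b[b-1]≤v[k-d]) (sym (nearest-xval-hval 0<v d<k σ<k))
  where
  0<v : + 0 ℤ.< + v
  0<v = ℤ.+<+ (IsSRG⇒0<v srg)
  ρσ≤0 : ρ ℤ.* σ ℤ.≤ + 0
  ρσ≤0 = subst (ℤ._≤ + 0) (sym ρσ≡μ-k)
                (ℤP.neg-mono-≤ (ℤP.i≤j⇒0≤j-i (ℤ.+≤+ (IsSRG⇒μ≤k srg))))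
  σ<k : σ ℤ.< + k
  σ<k = ℤP.≤-<-trans (ℤP.≤-trans (i<j⇒j*i≤0⇒i≤0 σ<ρ ρσ≤0) 0≤d) d<k
  b[b-1]≤v[k-d] : (+ k ℤ.- σ) ℤ.* (+ k ℤ.- σ ℤ.- + 1) ℤ.≤ + v ℤ.* (+ k ℤ.- d)
  b[b-1]≤v[k-d] = d≤k-c/v⇒c≤v[k-d] {+ v} {+ k} {d} 0<v
    (subst (λ c → ℤ→ℚ d ℚ.≤ ℕ→ℚ k ℚ.- c ÷' ℕ→ℚ v)
           (sym (ℤ→ℚ-* (+ k ℤ.- σ) (+ k ℤ.- σ ℤ.- + 1))) d≤k-b[b-1]/v)
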